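{- Let $G$ be a simple graph with $n$ vertices and minimum degree at least three, and let $e$ be an edge of $G$. Suppose that the length of the longest cycles of $G$ containing $e$ is at least $n-\frac{1+\sqrt{4n-3}}{2}+1$. Then every longest cycle of $G$ containing $e$ has a chord.
   Context: A longest cycle containing $e$ is a cycle of $G$ that contains the edge $e$ and has maximum length among all cycles of $G$ containing $e$. A chord of a cycle $C$ in $G$ is an edge of $G$ joining two vertices of $C$ that are not consecutive on $C$. -}

module Defs where

open import Data.Nat using (ℕ; _≤_; _+_; _*_; _∸_; _^_)
open import Data.Fin using (Fin)
open import Data.List using (List; []; _∷_; _++_; [_]; length; filter; allFin)
open import Data.List.Membership.Propositional using (_∈_)
open import Data.List.Relation.Unary.Unique.Propositional using (Unique)
open import Data.Product using (Σ; ∃; ∃-syntax; _×_; _,_)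
open import Data.Sum using (_⊎_)
open import Relation.Nullary using (¬_)
open import Relation.Binary using (Decidable; Symmetric; Irreflexive)
open import Relation.Binary.PropositionalEquality using (_≡_)
open import Level using (0ℓ)

record Graph (n : ℕ) : Set₁ where
  field
    Adj     : Fin n → Fin n → Set
    adj?    : Decidable Adj
    adjSym  : Symmetric Adj
    adjIrr  : Irreflexive _≡_ Adj

  degree : Fin n → ℕ
  degree v = length (filter (adj? v) (allFin n))

open Graph public

data Consec {A : Set} : List A → A → A → Set where
  here  : ∀ {x y rest} → Consec (x ∷ y ∷ rest) x y
  there : ∀ {z rest x y} → Consec rest x y → Consec (z ∷ rest) x y

close : {A : Set} → List A → List A
close []       = []
close (x ∷ xs) = x ∷ (xs ++ [ x ])

record Cycle {n : ℕ} (G : Graph n) : Set where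
  field
    verts    : List (Fin n)
    atLeast3 : 3 ≤ length verts
    distinct : Unique verts
    edges    : ∀ {u v} → Consec (close verts) u v → Adj G u v

open Cycle public

len : {n : ℕ} {G : Graph n} → Cycle G → ℕ
len C = length (verts C)

OnCycle : {n : ℕ} {G : Graph n} → Cycle G → Fin n → Fin n → Set
OnCycle C u v = Consec (close (verts C)) u v ⊎ Consec (close (verts C)) v u

ContainsEdge : {n : ℕ} {G : Graph n} → Cycle G → Fin n → Fin n → Set
ContainsEdge C x y = OnCycle C x y

LongestThrough : {n : ℕ} (G : Graph n) → Fin n → Fin n → Cycle G → Set
LongestThrough G x y C =
  ContainsEdge C x y × (∀ (D : Cycle G) → ContainsEdge D x y → len D ≤ len C)

HasChord : {n : ℕ} {G : Graph n} → Cycle G → Set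
HasChord {G = G} C =
  ∃[ u ] ∃[ v ] (u ∈ verts C × v ∈ verts C × Adj G u v × ¬ OnCycle C u v)

MinDegreeAtLeast : {n : ℕ} → Graph n → ℕ → Set
MinDegreeAtLeast {n} G k = ∀ (v : Fin n) → k ≤ degree G v

-- L ≥ n - (1 + √(4n-3))/2 + 1, written without reals (valid since L ≤ n):
-- with k = n + 1 - L ≥ 1 it is equivalent to 2k - 1 ≤ √(4n-3),
-- i.e. (2k - 1)^2 ≤ 4n - 3.
LengthBound : ℕ → ℕ → Set
LengthBound n L = (2 * (n + 1 ∸ L) ∸ 1) ^ 2 ≤ 4 * n ∸ 3

-- Let C be a chordless longest cycle through e = xy and delete e, leaving a
-- path y = v₁ … v_L = x that is longest among y–x paths. As C has no chord,
-- each vᵢ has only two neighbours on C but degree at least three, so it has a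
-- neighbour f(vᵢ) off C. If f(vᵢ) = f(vᵢ₊₁) the path can be lengthened by a
-- detour, and if (f(vᵢ), f(vᵢ₊₁)) = (f(vⱼ), f(vⱼ₊₁)) with i < j by crossing
-- over and walking vᵢ₊₁ … vⱼ backwards. So the pairs (f(vᵢ), f(vᵢ₊₁)), i < L,
-- and (f(v_L), f(v_L)) are L distinct pairs of the k = n − L vertices off C,
-- whence L ≤ k² and n ≤ k² + k, contradicting the assumed lower bound on L.

module Submission where

open import Defs
open import Data.Nat using (ℕ; suc; _+_; _*_; _∸_; _^_; _≤_; _<_; z≤n; s≤s; _≤?_)
open import Data.Nat.Properties
open import Data.Nat.Tactic.RingSolver using (solve-∀)
open import Data.Fin using (Fin) renaming (_≟_ to _≟ᶠ_)
open import Data.List using (List; []; _∷_; _++_; [_]; _∷ʳ_; length; map; reverse; filter; allFin; cartesianProduct)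
open import Data.List.Properties using (++-assoc; length-++; length-map; length-tabulate; unfold-reverse)
open import Data.List.Relation.Unary.Any using (Any; here; there; any?; satisfied)
open import Data.List.Relation.Unary.All as All using ([]; _∷_)
open import Data.List.Relation.Unary.All.Properties using (¬Any⇒All¬)
open import Data.List.Relation.Unary.AllPairs using ([]; _∷_)
open import Data.List.Membership.Propositional using (_∈_; _∉_; find; lose)
open import Data.List.Membership.Propositional.Properties
  using (∈-++⁺ˡ; ∈-++⁺ʳ; ∈-++⁻; ∈-∃++; ∈-allFin; ∈-filter⁺; ∈-filter⁻; ∈-cartesianProduct⁺)
open import Data.List.Relation.Binary.Subset.Propositional using (_⊆_)
open import Data.List.Relation.Unary.Unique.Propositional using (Unique)
open import Data.List.Relation.Unary.Unique.Propositional.Properties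
  using (Unique[x∷xs]⇒x∉xs; filter⁺; allFin⁺; ++⁺)
open import Data.List.Relation.Binary.Permutation.Propositional
  using (_↭_; ↭-refl; ↭-sym; ↭-trans; ↭-reflexive; ↭-prep; ↭-swap; ↭⇒↭ₛ; module PermutationReasoning)
open import Data.List.Relation.Binary.Permutation.Propositional.Properties
  using (shift; ++-comm; ++⁺ˡ; ++⁺ʳ; ∷↭∷ʳ; ↭-reverse; ↭-length; ∈-resp-↭)
import Data.List.Relation.Binary.Permutation.Setoid.Properties as Permutationₛ
open import Data.Product using (Σ; ∃; ∃₂; _×_; _,_; proj₁; proj₂)
open import Data.Product.Properties using (,-injectiveˡ; ,-injectiveʳ)
open import Data.Sum using (_⊎_; inj₁; inj₂)
open import Data.Empty using (⊥)
open import Function using (_∘_)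
open import Relation.Binary.Definitions using (DecidableEquality)
open import Relation.Binary.PropositionalEquality
  using (_≡_; _≢_; refl; sym; trans; cong; cong₂; subst; setoid; module ≡-Reasoning)
open import Relation.Nullary using (¬_; Dec; yes; no; ¬?; contradiction)
open import Relation.Nullary.Decidable using (_×-dec_; _⊎-dec_; map′; decidable-stable)

module _ {A : Set} where

  Consec⇒∈ˡ : ∀ {xs : List A} {u v} → Consec xs u v → u ∈ xs
  Consec⇒∈ˡ here      = here refl
  Consec⇒∈ˡ (there c) = there (Consec⇒∈ˡ c)

  Consec⇒∈ʳ : ∀ {xs : List A} {u v} → Consec xs u v → v ∈ xs
  Consec⇒∈ʳ here      = there (here refl)
  Consec⇒∈ʳ (there c) = there (Consec⇒∈ʳ c)

  Consec-∷⇒∈ʳ : ∀ {z : A} {xs u v} → Consec (z ∷ xs) u v → v ∈ xs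
  Consec-∷⇒∈ʳ here = here refl
  Consec-∷⇒∈ʳ {xs = _ ∷ _} (there c) = there (Consec-∷⇒∈ʳ c)

  Consec-∷ʳ⇒∈ˡ : ∀ xs {z u v : A} → Consec (xs ∷ʳ z) u v → u ∈ xs
  Consec-∷ʳ⇒∈ˡ [] (there ())
  Consec-∷ʳ⇒∈ˡ (x ∷ []) here = here refl
  Consec-∷ʳ⇒∈ˡ (x ∷ _ ∷ _) here = here refl
  Consec-∷ʳ⇒∈ˡ (x ∷ xs) (there c) = there (Consec-∷ʳ⇒∈ˡ xs c)

  Consec⇒++ : ∀ {xs : List A} {u v} → Consec xs u v → ∃₂ λ pre post → xs ≡ pre ++ u ∷ v ∷ post
  Consec⇒++ here = [] , _ , refl
  Consec⇒++ (there {z} c) with pre , post , eq ← Consec⇒++ c = z ∷ pre , post , cong (z ∷_) eq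

  Consec-∷⁻ : ∀ {z : A} {xs u v} → Consec (z ∷ xs) u v → u ≡ z ⊎ Consec xs u v
  Consec-∷⁻ here = inj₁ refl
  Consec-∷⁻ (there c) = inj₂ c

  Consec-∷ʳ⁻ : ∀ xs {z a b : A} → Consec (xs ∷ʳ z) a b →
               (∃₂ λ l₁ l₂ → xs ≡ l₁ ++ a ∷ b ∷ l₂) ⊎ (∃ λ l₁ → xs ≡ l₁ ∷ʳ a × b ≡ z)
  Consec-∷ʳ⁻ [] (there ())
  Consec-∷ʳ⁻ (x ∷ []) here = inj₂ ([] , refl , refl)
  Consec-∷ʳ⁻ (x ∷ []) (there (there ()))
  Consec-∷ʳ⁻ (x ∷ x′ ∷ xs) here = inj₁ ([] , xs , refl)
  Consec-∷ʳ⁻ (x ∷ x′ ∷ xs) (there c) with Consec-∷ʳ⁻ (x′ ∷ xs) c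
  ... | inj₁ (l₁ , l₂ , eq)  = inj₁ (x ∷ l₁ , l₂ , cong (x ∷_) eq)
  ... | inj₂ (l₁ , eq , b≡z) = inj₂ (x ∷ l₁ , cong (x ∷_) eq , b≡z)

  Consec-∷ʳ-successor-unique : ∀ xs {z v a b : A} → Unique xs →
                               Consec (xs ∷ʳ z) v a → Consec (xs ∷ʳ z) v b → a ≡ b
  Consec-∷ʳ-successor-unique [] _ (there ()) _
  Consec-∷ʳ-successor-unique (x ∷ []) _ here here = refl
  Consec-∷ʳ-successor-unique (x ∷ []) _ here (there (there ()))
  Consec-∷ʳ-successor-unique (x ∷ []) _ (there (there ())) _
  Consec-∷ʳ-successor-unique (x ∷ _ ∷ _) _ here here = refl
  Consec-∷ʳ-successor-unique (x ∷ xs@(_ ∷ _)) u here (there c) =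
    contradiction (Consec-∷ʳ⇒∈ˡ xs c) (Unique[x∷xs]⇒x∉xs u)
  Consec-∷ʳ-successor-unique (x ∷ xs@(_ ∷ _)) u (there c) here =
    contradiction (Consec-∷ʳ⇒∈ˡ xs c) (Unique[x∷xs]⇒x∉xs u)
  Consec-∷ʳ-successor-unique (x ∷ xs@(_ ∷ _)) (_ ∷ u) (there c) (there d) =
    Consec-∷ʳ-successor-unique xs u c d

  Consec-∷-predecessor-unique : ∀ {z : A} {xs v a b} → Unique xs →
                                Consec (z ∷ xs) a v → Consec (z ∷ xs) b v → a ≡ b
  Consec-∷-predecessor-unique _ here here = refl
  Consec-∷-predecessor-unique u here (there c) = contradiction (Consec-∷⇒∈ʳ c) (Unique[x∷xs]⇒x∉xs u)
  Consec-∷-predecessor-unique u (there c) here = contradiction (Consec-∷⇒∈ʳ c) (Unique[x∷xs]⇒x∉xs u)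
  Consec-∷-predecessor-unique (_ ∷ u) (there c) (there d) = Consec-∷-predecessor-unique u c d

  Consec? : DecidableEquality A → ∀ zs u v → Dec (Consec zs u v)
  Consec? _≟_ [] u v = no λ ()
  Consec? _≟_ (a ∷ []) u v = no λ { (there ()) }
  Consec? _≟_ (a ∷ b ∷ zs) u v with a ≟ u | b ≟ v | Consec? _≟_ (b ∷ zs) u v
  ... | yes refl | yes refl | _     = yes here
  ... | _        | _        | yes c = yes (there c)
  ... | no a≢u   | _        | no ¬c = no λ { here → a≢u refl ; (there c) → ¬c c }
  ... | yes _    | no b≢v   | no ¬c = no λ { here → b≢v refl ; (there c) → ¬c c }

  Unique-resp-↭ : ∀ {xs ys : List A} → xs ↭ ys → Unique xs → Unique ys
  Unique-resp-↭ σ = Permutationₛ.Unique-resp-↭ (setoid A) (↭⇒↭ₛ σ)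

  Unique-⊆⇒length≤ : ∀ {xs ys : List A} → Unique xs → xs ⊆ ys → length xs ≤ length ys
  Unique-⊆⇒length≤ {[]} _ _ = z≤n
  Unique-⊆⇒length≤ {x ∷ xs} x∷xs-unique@(_ ∷ xs-unique) xs⊆ys
    with ys₁ , ys₂ , refl ← ∈-∃++ (xs⊆ys (here refl)) = begin
      suc (length xs)           ≤⟨ s≤s (Unique-⊆⇒length≤ xs-unique xs⊆ys₁++ys₂) ⟩
      suc (length (ys₁ ++ ys₂)) ≡⟨ ↭-length (shift x ys₁ ys₂) ⟨
      length (ys₁ ++ x ∷ ys₂)   ∎
    where
      open ≤-Reasoning
      xs⊆ys₁++ys₂ : xs ⊆ ys₁ ++ ys₂
      xs⊆ys₁++ys₂ {z} z∈xs with ∈-++⁻ ys₁ (xs⊆ys (there z∈xs))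
      ... | inj₁ z∈ys₁         = ∈-++⁺ˡ z∈ys₁
      ... | inj₂ (here refl)   = contradiction z∈xs (Unique[x∷xs]⇒x∉xs x∷xs-unique)
      ... | inj₂ (there z∈ys₂) = ∈-++⁺ʳ ys₁ z∈ys₂

  shift-past : ∀ pre (a w : A) zs → pre ++ a ∷ w ∷ zs ↭ w ∷ pre ++ a ∷ zs
  shift-past pre a w zs = ↭-trans (++⁺ˡ pre (↭-swap a w ↭-refl)) (shift w pre (a ∷ zs))

  Unique-⊎-length≤2 : ∀ {P Q : A → Set} {xs} →
    (∀ {a b} → P a → P b → a ≡ b) → (∀ {a b} → Q a → Q b → a ≡ b) →
    Unique xs → (∀ {u} → u ∈ xs → P u ⊎ Q u) → length xs ≤ 2
  Unique-⊎-length≤2 {xs = []} _ _ _ _ = z≤n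
  Unique-⊎-length≤2 {xs = _ ∷ []} _ _ _ _ = s≤s z≤n
  Unique-⊎-length≤2 {xs = _ ∷ _ ∷ []} _ _ _ _ = s≤s (s≤s z≤n)
  Unique-⊎-length≤2 {xs = _ ∷ _ ∷ _ ∷ _} P! Q! ((u₁≢u₂ ∷ u₁≢u₃ ∷ _) ∷ (u₂≢u₃ ∷ _) ∷ _) side
    with side (here refl) | side (there (here refl)) | side (there (there (here refl)))
  ... | inj₁ p₁ | inj₁ p₂ | _       = contradiction (P! p₁ p₂) u₁≢u₂
  ... | inj₂ q₁ | inj₂ q₂ | _       = contradiction (Q! q₁ q₂) u₁≢u₂
  ... | inj₁ p₁ | inj₂ _  | inj₁ p₃ = contradiction (P! p₁ p₃) u₁≢u₃
  ... | inj₁ _  | inj₂ q₂ | inj₂ q₃ = contradiction (Q! q₂ q₃) u₂≢u₃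
  ... | inj₂ _  | inj₁ p₂ | inj₁ p₃ = contradiction (P! p₂ p₃) u₂≢u₃
  ... | inj₂ q₁ | inj₁ _  | inj₂ q₃ = contradiction (Q! q₁ q₃) u₁≢u₃

  length-cartesianProduct : ∀ {B : Set} (xs : List A) (ys : List B) →
                            length (cartesianProduct xs ys) ≡ length xs * length ys
  length-cartesianProduct [] ys = refl
  length-cartesianProduct (x ∷ xs) ys = begin
    length (map (x ,_) ys ++ cartesianProduct xs ys)
      ≡⟨ length-++ (map (x ,_) ys) ⟩
    length (map (x ,_) ys) + length (cartesianProduct xs ys)
      ≡⟨ cong₂ _+_ (length-map (x ,_) ys) (length-cartesianProduct xs ys) ⟩
    length ys + length xs * length ys
      ∎
    where open ≡-Reasoning

module _ {A B : Set} (f : A → B) where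

  pairsAlong : List A → List (B × B)
  pairsAlong []          = []
  pairsAlong (a ∷ [])    = [ (f a , f a) ]
  pairsAlong (a ∷ b ∷ r) = (f a , f b) ∷ pairsAlong (b ∷ r)

  length-pairsAlong : ∀ xs → length (pairsAlong xs) ≡ length xs
  length-pairsAlong []          = refl
  length-pairsAlong (a ∷ [])    = refl
  length-pairsAlong (a ∷ b ∷ r) = cong suc (length-pairsAlong (b ∷ r))

  pairsAlong-⊆ : ∀ {xs ys} → (∀ {a} → a ∈ xs → f a ∈ ys) → pairsAlong xs ⊆ cartesianProduct ys ys
  pairsAlong-⊆ {a ∷ []}    f∈ (here refl) = ∈-cartesianProduct⁺ (f∈ (here refl)) (f∈ (here refl))
  pairsAlong-⊆ {a ∷ b ∷ r} f∈ (here refl) = ∈-cartesianProduct⁺ (f∈ (here refl)) (f∈ (there (here refl)))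
  pairsAlong-⊆ {a ∷ b ∷ r} f∈ (there q∈) = pairsAlong-⊆ (λ a∈ → f∈ (there a∈)) q∈

  ∈-pairsAlong⁻ : ∀ xs {q} → q ∈ pairsAlong xs →
                  (∃ λ z → q ≡ (f z , f z)) ⊎ (∃₂ λ c d → Consec xs c d × q ≡ (f c , f d))
  ∈-pairsAlong⁻ (a ∷ [])    (here refl) = inj₁ (a , refl)
  ∈-pairsAlong⁻ (a ∷ b ∷ r) (here refl) = inj₂ (a , b , here , refl)
  ∈-pairsAlong⁻ (a ∷ b ∷ r) (there q∈) with ∈-pairsAlong⁻ (b ∷ r) q∈
  ... | inj₁ diagonal          = inj₁ diagonal
  ... | inj₂ (c , d , cd , eq) = inj₂ (c , d , there cd , eq)

  pairsAlong-unique : ∀ xs →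
    (∀ pre {a b} post → xs ≡ pre ++ a ∷ b ∷ post → f a ≢ f b) →
    (∀ pre {a b r c d} → xs ≡ pre ++ a ∷ b ∷ r → Consec r c d → (f a , f b) ≢ (f c , f d)) →
    Unique (pairsAlong xs)
  pairsAlong-unique []          _  _  = []
  pairsAlong-unique (a ∷ [])    _  _  = [] ∷ []
  pairsAlong-unique (a ∷ b ∷ r) H₁ H₂ =
    All.tabulate (head-differs ∘ ∈-pairsAlong⁻ (b ∷ r)) ∷
    pairsAlong-unique (b ∷ r) (λ pre post eq → H₁ (a ∷ pre) post (cong (a ∷_) eq))
                              (λ pre eq → H₂ (a ∷ pre) (cong (a ∷_) eq))
    where
      fa≢fb : f a ≢ f b
      fa≢fb = H₁ [] r refl
      head-differs : ∀ {q} → (∃ λ z → q ≡ (f z , f z)) ⊎ (∃₂ λ c d → Consec (b ∷ r) c d × q ≡ (f c , f d)) →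
                     (f a , f b) ≢ q
      head-differs (inj₁ (z , refl)) eq = fa≢fb (trans (,-injectiveˡ eq) (sym (,-injectiveʳ eq)))
      head-differs (inj₂ (c , d , cd , refl)) with Consec-∷⁻ cd
      ... | inj₁ refl = fa≢fb ∘ ,-injectiveˡ
      ... | inj₂ cd′  = H₂ [] refl cd′

module _ {n : ℕ} (G : Graph n) where

  infixr 5 _◅_

  data Path : Fin n → Fin n → List (Fin n) → Set where
    ε   : ∀ {a} → Path a a [ a ]
    _◅_ : ∀ {a b t xs} → Adj G a b → Path b t (b ∷ xs) → Path a t (a ∷ b ∷ xs)

  step : ∀ {a b t xs} → Adj G a b → Path b t xs → Path a t (a ∷ xs)
  step e p@ε       = e ◅ p
  step e p@(_ ◅ _) = e ◅ p

  snoc : ∀ {s m t xs} → Path s m xs → Adj G m t → Path s t (xs ∷ʳ t)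
  snoc ε        e = e ◅ ε
  snoc (e′ ◅ p) e = e′ ◅ snoc p e

  glue : ∀ xs {s m t ys} → Path s m (xs ∷ʳ m) → Path m t ys → Path s t (xs ++ ys)
  glue []            ε       q = q
  glue (x ∷ [])      (e ◅ ε) q = step e q
  glue (x ∷ x′ ∷ xs) (e ◅ p) q = e ◅ glue (x′ ∷ xs) p q

  split : ∀ xs {s t a ys} → Path s t (xs ++ a ∷ ys) → Path s a (xs ∷ʳ a) × Path a t (a ∷ ys)
  split []            p@ε       = ε , p
  split []            p@(_ ◅ _) = ε , p
  split (x ∷ [])      (e ◅ p)   = e ◅ ε , p
  split (x ∷ x′ ∷ xs) (e ◅ p)   with p₁ , p₂ ← split (x′ ∷ xs) p = e ◅ p₁ , p₂

  reverse-path : ∀ {s t xs} → Path s t xs → Path t s (reverse xs)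
  reverse-path ε = ε
  reverse-path {s} {xs = s ∷ xs} (e ◅ p) =
    subst (Path _ s) (sym (unfold-reverse s xs)) (snoc (reverse-path p) (adjSym G e))

  fromConsec : ∀ a xs z → (∀ {u v} → Consec (a ∷ xs ++ [ z ]) u v → Adj G u v) → Path a z (a ∷ xs ++ [ z ])
  fromConsec a []       z E = E here ◅ ε
  fromConsec a (b ∷ xs) z E = E here ◅ fromConsec b xs z (λ c → E (there c))

  Path⇒Adj : ∀ {s t xs u v} → Path s t xs → Consec xs u v → Adj G u v
  Path⇒Adj ε       (there ())
  Path⇒Adj (e ◅ _) here      = e
  Path⇒Adj (_ ◅ p) (there c) = Path⇒Adj p c

  Path⇒Consec-∷ʳ : ∀ {s t xs z} → Path s t xs → Consec (xs ∷ʳ z) t z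
  Path⇒Consec-∷ʳ ε       = here
  Path⇒Consec-∷ʳ (_ ◅ p) = there (Path⇒Consec-∷ʳ p)

  -- Cut the closed walk s … a b … s at the edge ab and rejoin it at s.
  rotate : ∀ xs {s a b} → Path s s (xs ∷ʳ s) → Consec (xs ∷ʳ s) a b → ∃ λ p → Path b a p × xs ↭ p
  rotate xs {s} walk c with Consec-∷ʳ⁻ xs c
  ... | inj₁ (l₁ , l₂ , refl)
      with toA , _ ◅ fromB ← split l₁ (subst (Path s s) (++-assoc l₁ _ [ s ]) walk)
      = _ , glue (_ ∷ l₂) fromB toA ,
        ↭-trans (↭-reflexive (sym (++-assoc l₁ [ _ ] (_ ∷ l₂)))) (++-comm (l₁ ∷ʳ _) (_ ∷ l₂))
  ... | inj₂ (l₁ , refl , refl) =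
      _ , proj₁ (split l₁ (subst (Path s s) (++-assoc l₁ _ [ s ]) walk)) , ↭-refl

  closed-walk-path : ∀ xs {a b} → (∀ {u v} → Consec (close xs) u v → Adj G u v) →
                     Consec (close xs) a b → ∃ λ p → Path b a p × xs ↭ p
  closed-walk-path []      _ ()
  closed-walk-path (h ∷ t) E c = rotate (h ∷ t) (fromConsec h t h E) c

module _ {n : ℕ} {G : Graph n} where
  open import Data.List.Membership.DecPropositional (_≟ᶠ_ {n}) using (_∈?_)

  cycle-of-path : ∀ {x y q} → Path G y x q → Adj G x y → Unique q → 3 ≤ length q →
                  Σ (Cycle G) λ D → verts D ≡ q × ContainsEdge D x y
  cycle-of-path {q = q} p@(_ ◅ _) xy q-unique 3≤q =
    record { verts = q ; atLeast3 = 3≤q ; distinct = q-unique ; edges = Path⇒Adj G (snoc G p xy) } ,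
    refl , inj₁ (Path⇒Consec-∷ʳ G p)
  cycle-of-path ε _ _ (s≤s ())

  module _ (C : Cycle G) where

    cycle-minus-edge : ∀ {x y} → ContainsEdge C x y → ∃ λ p → Path G y x p × verts C ↭ p
    cycle-minus-edge (inj₁ c) = closed-walk-path G (verts C) (edges C) c
    cycle-minus-edge (inj₂ c) with p , P , σ ← closed-walk-path G (verts C) (edges C) c =
      reverse p , reverse-path G P , ↭-trans σ (↭-sym (↭-reverse p))

    OnCycle? : ∀ u v → Dec (OnCycle C u v)
    OnCycle? u v = Consec? _≟ᶠ_ (close (verts C)) u v ⊎-dec Consec? _≟ᶠ_ (close (verts C)) v u

    hasChord? : Dec (HasChord C)
    hasChord? = map′ fromAny toAny (any? (λ u → any? (chord? u) (verts C)) (verts C))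
      where
        Chord : Fin n → Fin n → Set
        Chord u v = Adj G u v × ¬ OnCycle C u v
        chord? : ∀ u v → Dec (Chord u v)
        chord? u v = adj? G u v ×-dec ¬? (OnCycle? u v)
        fromAny : Any (λ u → Any (Chord u) (verts C)) (verts C) → HasChord C
        fromAny chords with u , u∈C , chords-at-u ← find chords with v , v∈C , chord ← find chords-at-u =
          u , v , u∈C , v∈C , chord
        toAny : HasChord C → Any (λ u → Any (Chord u) (verts C)) (verts C)
        toAny (u , v , u∈C , v∈C , chord) = lose u∈C (lose v∈C chord)

    OnCycle-length≤2 : ∀ {v N} → Unique N → (∀ {u} → u ∈ N → OnCycle C v u) → length N ≤ 2
    OnCycle-length≤2 = Unique-⊎-length≤2 (successor (verts C) (distinct C)) (predecessor (verts C) (distinct C))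
      where
        successor : ∀ xs → Unique xs → ∀ {v a b} → Consec (close xs) v a → Consec (close xs) v b → a ≡ b
        successor []      _ ()
        successor (h ∷ t) u = Consec-∷ʳ-successor-unique (h ∷ t) u
        predecessor : ∀ xs → Unique xs → ∀ {v a b} → Consec (close xs) a v → Consec (close xs) b v → a ≡ b
        predecessor []      _ ()
        predecessor (h ∷ t) u = Consec-∷-predecessor-unique (Unique-resp-↭ (∷↭∷ʳ h t) u)

    off-cycle-neighbour : MinDegreeAtLeast G 3 → ¬ HasChord C →
                          ∀ {v} → v ∈ verts C → ∃ λ w → Adj G v w × w ∉ verts C
    off-cycle-neighbour δ≥3 chordless {v} v∈C =
      satisfied (decidable-stable (any? exit? (allFin n)) no-exit-absurd)
      where
        exit? : ∀ w → Dec (Adj G v w × w ∉ verts C)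
        exit? w = adj? G v w ×-dec ¬? (w ∈? verts C)
        -- Without a chord every neighbour of v is one of its two neighbours along C.
        no-exit-absurd : ¬ ¬ Any (λ w → Adj G v w × w ∉ verts C) (allFin n)
        no-exit-absurd no-exit =
          ≤⇒≯ (OnCycle-length≤2 (filter⁺ (adj? G v) (allFin⁺ n)) neighbour-on-cycle) (δ≥3 v)
          where
            neighbour-on-cycle : ∀ {w} → w ∈ filter (adj? G v) (allFin n) → OnCycle C v w
            neighbour-on-cycle {w} w∈N =
              decidable-stable (OnCycle? v w) λ ¬on → chordless (v , w , v∈C , w∈C , vw , ¬on)
              where
                vw : Adj G v w
                vw = proj₂ (∈-filter⁻ (adj? G v) {xs = allFin n} w∈N)
                w∈C : w ∈ verts C
                w∈C = decidable-stable (w ∈? verts C) λ w∉C → no-exit (lose (∈-allFin w) (vw , w∉C))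

module LongestPath {n : ℕ} (G : Graph n) {y x : Fin n} {ps : List (Fin n)}
                   (P : Path G y x ps) (ps-unique : Unique ps)
                   (longest : ∀ {q} → Path G y x q → Unique q → length q ≤ length ps) where
  open import Data.List.Membership.DecPropositional (_≟ᶠ_ {n}) using (_∈?_)

  no-extension : ∀ {q} w ws → Path G y x q → q ↭ w ∷ ws ++ ps → Unique (w ∷ ws ++ ps) → ⊥
  no-extension {q} w ws Q σ extended-unique =
    <⇒≱ ps<q (longest Q (Unique-resp-↭ (↭-sym σ) extended-unique))
    where
      open ≤-Reasoning
      ps<q : length ps < length q
      ps<q = begin-strict
        length ps               ≤⟨ m≤n+m (length ps) (length ws) ⟩
        length ws + length ps   ≡⟨ length-++ ws ⟨
        length (ws ++ ps)       <⟨ n<1+n _ ⟩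
        length (w ∷ ws ++ ps)   ≡⟨ ↭-length σ ⟨
        length q                ∎

  no-detour : ∀ pre {a b post w} → ps ≡ pre ++ a ∷ b ∷ post →
              Adj G a w → Adj G w b → w ∉ ps → ⊥
  no-detour pre {a} {b} {post} {w} eq aw wb w∉ps
    with toA , _ ◅ fromB ← split G pre (subst (Path G y x) eq P) =
    no-extension w [] (glue G pre toA (aw ◅ wb ◅ fromB))
      (subst (λ zs → _ ↭ w ∷ zs) (sym eq) (shift-past pre a w (b ∷ post)))
      (¬Any⇒All¬ ps w∉ps ∷ ps-unique)

  -- Reroute along y … a w c … b u d … x, walking the segment b … c backwards.
  no-crossing : ∀ pre {a b r c d w u} → ps ≡ pre ++ a ∷ b ∷ r → Consec r c d →
                Adj G a w → Adj G w c → Adj G b u → Adj G u d → w ∉ ps → u ∉ ps → w ≢ u → ⊥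
  no-crossing pre {a} {b} {c = c} {d} {w} {u} eq cd aw wc bu ud w∉ps u∉ps w≢u
    with mid , post , refl ← Consec⇒++ cd
    with toA , _ ◅ fromB ← split G pre (subst (Path G y x) eq P)
    with bToC , _ ◅ fromD ← split G (b ∷ mid) fromB =
    no-extension w [ u ] crossed σ
      ((w≢u ∷ ¬Any⇒All¬ ps w∉ps) ∷ ¬Any⇒All¬ ps u∉ps ∷ ps-unique)
    where
      seg = (b ∷ mid) ∷ʳ c
      crossed : Path G y x (pre ++ a ∷ w ∷ reverse seg ++ u ∷ d ∷ post)
      crossed = glue G pre toA (aw ◅ step G wc cToX)
        where cToX = glue G (reverse seg) (snoc G (reverse-path G bToC) bu) (ud ◅ fromD)
      open PermutationReasoning
      σ : pre ++ a ∷ w ∷ reverse seg ++ u ∷ d ∷ post ↭ w ∷ u ∷ ps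
      σ = begin
        pre ++ a ∷ w ∷ reverse seg ++ u ∷ d ∷ post
          ↭⟨ shift-past pre a w _ ⟩
        w ∷ pre ++ a ∷ reverse seg ++ u ∷ d ∷ post
          ↭⟨ ↭-prep w (++⁺ˡ pre (↭-prep a (shift u (reverse seg) (d ∷ post)))) ⟩
        w ∷ pre ++ a ∷ u ∷ reverse seg ++ d ∷ post
          ↭⟨ ↭-prep w (shift-past pre a u _) ⟩
        w ∷ u ∷ pre ++ a ∷ reverse seg ++ d ∷ post
          ↭⟨ ↭-prep w (↭-prep u (++⁺ˡ pre (↭-prep a (++⁺ʳ (d ∷ post) (↭-reverse seg))))) ⟩
        w ∷ u ∷ pre ++ a ∷ seg ++ d ∷ post
          ≡⟨ cong (λ zs → w ∷ u ∷ pre ++ a ∷ b ∷ zs) (++-assoc mid [ c ] (d ∷ post)) ⟩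
        w ∷ u ∷ pre ++ a ∷ b ∷ mid ++ c ∷ d ∷ post
          ≡⟨ cong (w ∷_) (cong (u ∷_) eq) ⟨
        w ∷ u ∷ ps
          ∎

  module _ (off : ∀ {v} → v ∈ ps → ∃ λ w → Adj G v w × w ∉ ps) where

    out : Fin n → Fin n
    out v with v ∈? ps
    ... | yes v∈ps = proj₁ (off v∈ps)
    ... | no _     = v

    out-adjacent : ∀ {v} → v ∈ ps → Adj G v (out v)
    out-adjacent {v} v∈ps with v ∈? ps
    ... | yes v∈ps′ = proj₁ (proj₂ (off v∈ps′))
    ... | no v∉ps   = contradiction v∈ps v∉ps

    out-∉ : ∀ {v} → v ∈ ps → out v ∉ ps
    out-∉ {v} v∈ps with v ∈? ps
    ... | yes v∈ps′ = proj₂ (proj₂ (off v∈ps′))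
    ... | no v∉ps   = contradiction v∈ps v∉ps

    out-adjacent-via : ∀ {v z} → v ∈ ps → out z ≡ out v → Adj G (out z) v
    out-adjacent-via v∈ps eq = subst (λ t → Adj G t _) (sym eq) (adjSym G (out-adjacent v∈ps))

    on-path : ∀ pre {zs z} → ps ≡ pre ++ zs → z ∈ zs → z ∈ ps
    on-path pre eq z∈zs = subst (_ ∈_) (sym eq) (∈-++⁺ʳ pre z∈zs)

    out-≢-along : ∀ pre {a b} post → ps ≡ pre ++ a ∷ b ∷ post → out a ≢ out b
    out-≢-along pre _ eq outs≡ =
      no-detour pre eq (out-adjacent a∈ps) (out-adjacent-via b∈ps outs≡) (out-∉ a∈ps)
      where
        a∈ps = on-path pre eq (here refl)
        b∈ps = on-path pre eq (there (here refl))

    out-pairs-distinct : ∀ pre {a b r c d} → ps ≡ pre ++ a ∷ b ∷ r → Consec r c d →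
                         (out a , out b) ≢ (out c , out d)
    out-pairs-distinct pre {r = r} eq cd pairs≡ =
      no-crossing pre eq cd
        (out-adjacent a∈ps) (out-adjacent-via c∈ps (,-injectiveˡ pairs≡))
        (out-adjacent b∈ps) (out-adjacent-via d∈ps (,-injectiveʳ pairs≡))
        (out-∉ a∈ps) (out-∉ b∈ps) (out-≢-along pre r eq)
      where
        a∈ps = on-path pre eq (here refl)
        b∈ps = on-path pre eq (there (here refl))
        c∈ps = on-path pre eq (there (there (Consec⇒∈ˡ cd)))
        d∈ps = on-path pre eq (there (there (Consec⇒∈ʳ cd)))

    offPath : List (Fin n)
    offPath = filter (λ v → ¬? (v ∈? ps)) (allFin n)

    length≤offPath² : length ps ≤ length offPath * length offPath
    length≤offPath² = begin
      length ps                                  ≡⟨ length-pairsAlong out ps ⟨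
      length (pairsAlong out ps)                 ≤⟨ Unique-⊆⇒length≤ pairs-unique (pairsAlong-⊆ out out∈offPath) ⟩
      length (cartesianProduct offPath offPath)  ≡⟨ length-cartesianProduct offPath offPath ⟩
      length offPath * length offPath            ∎
      where
        open ≤-Reasoning
        pairs-unique = pairsAlong-unique out ps out-≢-along out-pairs-distinct
        out∈offPath : ∀ {v} → v ∈ ps → out v ∈ offPath
        out∈offPath v∈ps = ∈-filter⁺ (λ v → ¬? (v ∈? ps)) (∈-allFin _) (out-∉ v∈ps)

    offPath+length≤n : length offPath + length ps ≤ n
    offPath+length≤n = begin
      length offPath + length ps  ≡⟨ length-++ offPath ⟨
      length (offPath ++ ps)      ≤⟨ Unique-⊆⇒length≤ both-unique (λ {v} _ → ∈-allFin v) ⟩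
      length (allFin n)           ≡⟨ length-tabulate _ ⟩
      n                           ∎
      where
        open ≤-Reasoning
        disjoint : ∀ {v} → ¬ (v ∈ offPath × v ∈ ps)
        disjoint (v∈off , v∈ps) = proj₂ (∈-filter⁻ (λ v → ¬? (v ∈? ps)) {xs = allFin n} v∈off) v∈ps
        both-unique = ++⁺ (filter⁺ _ (allFin⁺ n)) ps-unique disjoint

longest-cycle⇒longest-path : ∀ {n} (G : Graph n) {x y} (C : Cycle G) {ps} →
  Adj G x y → LongestThrough G x y C → verts C ↭ ps →
  ∀ {q} → Path G y x q → Unique q → length q ≤ length ps
longest-cycle⇒longest-path G C xy C-longest σ {q} Q q-unique with 3 ≤? length q
... | yes 3≤q with D , refl , D∋xy ← cycle-of-path Q xy q-unique 3≤q =
  ≤-trans (proj₂ C-longest D D∋xy) (≤-reflexive (↭-length σ))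
... | no 3≰q = ≤-trans (<⇒≤ (≰⇒> 3≰q)) (≤-trans (atLeast3 C) (≤-reflexive (↭-length σ)))

chordless-longest-cycle-short : ∀ {n} (G : Graph n) → MinDegreeAtLeast G 3 → ∀ {x y} → Adj G x y →
  ∀ C → LongestThrough G x y C → ¬ HasChord C → ∃ λ k → len C ≤ k * k × k + len C ≤ n
chordless-longest-cycle-short {n} G δ≥3 xy C C-longest chordless
  with ps , P , σ ← cycle-minus-edge C (proj₁ C-longest) =
  k , subst (_≤ k * k) ps≡C (length≤offPath² off) ,
  subst (λ L → k + L ≤ n) ps≡C (offPath+length≤n off)
  where
    open LongestPath G P (Unique-resp-↭ σ (distinct C)) (longest-cycle⇒longest-path G C xy C-longest σ)
    ps≡C : length ps ≡ len C
    ps≡C = sym (↭-length σ)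
    off : ∀ {v} → v ∈ ps → ∃ λ w → Adj G v w × w ∉ ps
    off v∈ps with w , vw , w∉C ← off-cycle-neighbour C δ≥3 chordless (∈-resp-↭ (↭-sym σ) v∈ps) =
      w , vw , λ w∈ps → w∉C (∈-resp-↭ (↭-sym σ) w∈ps)
    k = length (offPath off)

lengthBound-fails : ∀ {n L} k → L ≤ k * k → k + L ≤ n → ¬ LengthBound n L
lengthBound-fails {n} {L} k L≤k² k+L≤n bound = <-irrefl refl (begin-strict
    4 * (r * r + r)               <⟨ n<1+n _ ⟩
    suc (4 * (r * r + r))         ≡⟨ bound-lhs ⟨
    (2 * (n + 1 ∸ L) ∸ 1) ^ 2     ≤⟨ bound ⟩
    4 * n ∸ 3                     ≤⟨ m∸n≤m (4 * n) 3 ⟩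
    4 * n                         ≤⟨ *-monoʳ-≤ 4 n≤r²+r ⟩
    4 * (r * r + r)               ∎)
  where
    open ≤-Reasoning
    r = n ∸ L
    L≤n : L ≤ n
    L≤n = m+n≤o⇒n≤o k k+L≤n
    k≤r : k ≤ r
    k≤r = m+n≤o⇒m≤o∸n k k+L≤n
    n≤r²+r : n ≤ r * r + r
    n≤r²+r = subst (_≤ r * r + r) (m+[n∸m]≡n L≤n) (+-monoˡ-≤ r (≤-trans L≤k² (*-mono-≤ k≤r k≤r)))
    double-suc : ∀ m → 2 * (m + 1) ≡ 2 + 2 * m
    double-suc = solve-∀
    odd-square : ∀ m → (1 + 2 * m) * (1 + 2 * m) ≡ 1 + 4 * (m * m + m)
    odd-square = solve-∀
    bound-lhs : (2 * (n + 1 ∸ L) ∸ 1) ^ 2 ≡ suc (4 * (r * r + r))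
    bound-lhs = begin-equality
      (2 * (n + 1 ∸ L) ∸ 1) ^ 2  ≡⟨ cong (λ m → (2 * m ∸ 1) ^ 2) (+-∸-comm 1 L≤n) ⟩
      (2 * (r + 1) ∸ 1) ^ 2      ≡⟨ cong (λ m → (m ∸ 1) ^ 2) (double-suc r) ⟩
      (1 + 2 * r) ^ 2            ≡⟨ cong ((1 + 2 * r) *_) (*-identityʳ (1 + 2 * r)) ⟩
      (1 + 2 * r) * (1 + 2 * r)  ≡⟨ odd-square r ⟩
      suc (4 * (r * r + r))      ∎

theorem1p8 : (n : ℕ) (G : Graph n) → MinDegreeAtLeast G 3 →
    (x y : Fin n) → Adj G x y →
    (C : Cycle G) → LongestThrough G x y C → LengthBound n (len C) →
    HasChord C
theorem1p8 n G δ≥3 x y xy C C-longest bound with hasChord? C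
... | yes chord = chord
... | no chordless with k , C≤k² , k+C≤n ← chordless-longest-cycle-short G δ≥3 xy C C-longest chordless =
  contradiction bound (lengthBound-fails k C≤k² k+C≤n)
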